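{- The category $S4_{\Box\Diamond\sharp}$ is maximal: if the definition of $S4_{\Box\Diamond\sharp}$ is extended by any new equation $f=g$ between arrow terms of the same type (new meaning that it does not hold in $S4_{\Box\Diamond\sharp}$), assumed universally, then the resulting category is a preorder.
   Context: The category $S4_{\Box\Diamond}$ has as objects modalities, i.e.\ finite (possibly empty) sequences of the symbols $\Box$ and $\Diamond$, denoted $A,B,\ldots$. Its primitive arrow terms are $\mathbf{1}_A\colon A\vdash A$, $\varepsilon^\Box_A\colon \Box A\vdash A$, $\delta^{\Box\Box}_A\colon \Box A\vdash\Box\Box A$, $\varepsilon^\Diamond_A\colon A\vdash\Diamond A$ and $\delta^{\Diamond\Diamond}_A\colon\Diamond\Diamond A\vdash\Diamond A$; arrow terms are closed under composition $\circ$ and under $f\mapsto Mf$ for $M\in\{\Box,\Diamond\}$ (if $f\colon A\vdash B$ then $Mf\colon MA\vdash MB$). Arrows are equivalence classes of arrow terms under: the categorial equations ($f\circ\mathbf{1}=\mathbf{1}\circ f=f$, associativity); functoriality of $\Box$ and $\Diamond$; naturality of $\varepsilon^\Box,\delta^{\Box\Box},\varepsilon^\Diamond,\delta^{\Diamond\Diamond}$; $\Box\delta^{\Box\Box}_A\circ\delta^{\Box\Box}_A=\delta^{\Box\Box}_{\Box A}\circ\delta^{\Box\Box}_A$, $\varepsilon^\Box_{\Box A}\circ\delta^{\Box\Box}_A=\mathbf{1}_{\Box A}$, $\Box\varepsilon^\Box_A\circ\delta^{\Box\Box}_A=\mathbf{1}_{\Box A}$ (comonad equations), and dually $\delta^{\Diamond\Diamond}_A\circ\Diamond\delta^{\Diamond\Diamond}_A=\delta^{\Diamond\Diamond}_A\circ\delta^{\Diamond\Diamond}_{\Diamond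 A}$, $\delta^{\Diamond\Diamond}_A\circ\varepsilon^\Diamond_{\Diamond A}=\mathbf{1}_{\Diamond A}$, $\delta^{\Diamond\Diamond}_A\circ\Diamond\varepsilon^\Diamond_A=\mathbf{1}_{\Diamond A}$ (monad equations). The category $S4_{\Box\Diamond\sharp}$ is defined like $S4_{\Box\Diamond}$ with the additional equations $\Box\varepsilon^\Box_A=\varepsilon^\Box_{\Box A}$ and $\Diamond\varepsilon^\Diamond_A=\varepsilon^\Diamond_{\Diamond A}$. An equation is assumed universally when, together with it, one assumes all equations obtained from it by appending an arbitrary modality on the right-hand side of the subscripts of the primitive arrow terms. A category is a preorder when any two arrows with the same source and target are equal. -}

module Defs where

open import Data.List using (List; []; _∷_; _++_)
open import Relation.Binary.PropositionalEquality using (_≡_)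

data Sym : Set where
  □ ◇ : Sym

-- Modalities: finite (possibly empty) sequences of □ and ◇.
-- The modality M A (M a symbol) is M ∷ A.
Mod : Set
Mod = List Sym

data Term : Mod → Mod → Set where
  𝟙    : (A : Mod) → Term A A
  ε□   : (A : Mod) → Term (□ ∷ A) A
  δ□□  : (A : Mod) → Term (□ ∷ A) (□ ∷ □ ∷ A)
  ε◇   : (A : Mod) → Term A (◇ ∷ A)
  δ◇◇  : (A : Mod) → Term (◇ ∷ ◇ ∷ A) (◇ ∷ A)
  _∘_  : {A B C : Mod} → Term B C → Term A B → Term A C
  [_]_ : {A B : Mod} (M : Sym) → Term A B → Term (M ∷ A) (M ∷ B)

infixr 9 _∘_
infixr 10 [_]_

_⊲_ : {A B : Mod} → Term A B → (E : Mod) → Term (A ++ E) (B ++ E)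
𝟙 A     ⊲ E = 𝟙 (A ++ E)
ε□ A    ⊲ E = ε□ (A ++ E)
δ□□ A   ⊲ E = δ□□ (A ++ E)
ε◇ A    ⊲ E = ε◇ (A ++ E)
δ◇◇ A   ⊲ E = δ◇◇ (A ++ E)
(g ∘ f) ⊲ E = (g ⊲ E) ∘ (f ⊲ E)
([ M ] f) ⊲ E = [ M ] (f ⊲ E)

Axioms : Set₁
Axioms = {A B : Mod} → Term A B → Term A B → Set

data NoAx : Axioms where

-- The equation f = g assumed universally: all instances f ⊲ E = g ⊲ E.
data Universally {A B : Mod} (f g : Term A B) : Axioms where
  inst : (E : Mod) → Universally f g (f ⊲ E) (g ⊲ E)

data _⊢_≈_ (Ax : Axioms) : {A B : Mod} → Term A B → Term A B → Set where
  ≈-refl  : {A B : Mod} {f : Term A B} → Ax ⊢ f ≈ f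
  ≈-sym   : {A B : Mod} {f g : Term A B} → Ax ⊢ f ≈ g → Ax ⊢ g ≈ f
  ≈-trans : {A B : Mod} {f g h : Term A B} → Ax ⊢ f ≈ g → Ax ⊢ g ≈ h → Ax ⊢ f ≈ h
  ∘-cong  : {A B C : Mod} {f f' : Term A B} {g g' : Term B C} →
            Ax ⊢ g ≈ g' → Ax ⊢ f ≈ f' → Ax ⊢ (g ∘ f) ≈ (g' ∘ f')
  M-cong  : {A B : Mod} (M : Sym) {f f' : Term A B} →
            Ax ⊢ f ≈ f' → Ax ⊢ ([ M ] f) ≈ ([ M ] f')
  ax      : {A B : Mod} {f g : Term A B} → Ax f g → Ax ⊢ f ≈ g
  idʳ     : {A B : Mod} (f : Term A B) → Ax ⊢ (f ∘ 𝟙 A) ≈ f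
  idˡ     : {A B : Mod} (f : Term A B) → Ax ⊢ (𝟙 B ∘ f) ≈ f
  assoc   : {A B C D : Mod} (h : Term C D) (g : Term B C) (f : Term A B) →
            Ax ⊢ (h ∘ (g ∘ f)) ≈ ((h ∘ g) ∘ f)
  M-id    : (M : Sym) (A : Mod) → Ax ⊢ ([ M ] 𝟙 A) ≈ 𝟙 (M ∷ A)
  M-∘     : (M : Sym) {A B C : Mod} (g : Term B C) (f : Term A B) →
            Ax ⊢ ([ M ] (g ∘ f)) ≈ (([ M ] g) ∘ ([ M ] f))
  nat-ε□  : {A B : Mod} (f : Term A B) → Ax ⊢ (f ∘ ε□ A) ≈ (ε□ B ∘ [ □ ] f)
  nat-δ□□ : {A B : Mod} (f : Term A B) →
            Ax ⊢ (([ □ ] [ □ ] f) ∘ δ□□ A) ≈ (δ□□ B ∘ [ □ ] f)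
  nat-ε◇  : {A B : Mod} (f : Term A B) → Ax ⊢ (([ ◇ ] f) ∘ ε◇ A) ≈ (ε◇ B ∘ f)
  nat-δ◇◇ : {A B : Mod} (f : Term A B) →
            Ax ⊢ (([ ◇ ] f) ∘ δ◇◇ A) ≈ (δ◇◇ B ∘ ([ ◇ ] [ ◇ ] f))
  □-assoc : (A : Mod) → Ax ⊢ (([ □ ] δ□□ A) ∘ δ□□ A) ≈ (δ□□ (□ ∷ A) ∘ δ□□ A)
  □-unitˡ : (A : Mod) → Ax ⊢ (ε□ (□ ∷ A) ∘ δ□□ A) ≈ 𝟙 (□ ∷ A)
  □-unitʳ : (A : Mod) → Ax ⊢ (([ □ ] ε□ A) ∘ δ□□ A) ≈ 𝟙 (□ ∷ A)
  ◇-assoc : (A : Mod) → Ax ⊢ (δ◇◇ A ∘ ([ ◇ ] δ◇◇ A)) ≈ (δ◇◇ A ∘ δ◇◇ (◇ ∷ A))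
  ◇-unitˡ : (A : Mod) → Ax ⊢ (δ◇◇ A ∘ ε◇ (◇ ∷ A)) ≈ 𝟙 (◇ ∷ A)
  ◇-unitʳ : (A : Mod) → Ax ⊢ (δ◇◇ A ∘ ([ ◇ ] ε◇ A)) ≈ 𝟙 (◇ ∷ A)
  ♯□      : (A : Mod) → Ax ⊢ ([ □ ] ε□ A) ≈ ε□ (□ ∷ A)
  ♯◇      : (A : Mod) → Ax ⊢ ([ ◇ ] ε◇ A) ≈ ε◇ (◇ ∷ A)

_≈♯_ : {A B : Mod} → Term A B → Term A B → Set
f ≈♯ g = NoAx ⊢ f ≈ g

Ext : {A B : Mod} (f g : Term A B) → {C D : Mod} → Term C D → Term C D → Set
Ext f g h k = Universally f g ⊢ h ≈ k

IsPreorder : Axioms → Set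
IsPreorder Ax = {C D : Mod} (h k : Term C D) → Ax ⊢ h ≈ k

-- In S4_{□◇♯} the equations ♯ make □□ ≅ □ and ◇◇ ≅ ◇, so every modality is a retract
-- of an alternating one and it suffices to compare arrows between alternating modalities.
-- Every arrow is equal to a normal form built from erasing a □, inserting a ◇, and keeping,
-- copying or merging a symbol; on alternating modalities two normal forms with the same
-- spine (the sequence of kept symbols) are equal. If f ≠ g, their normal forms have different
-- spines; stripping outer ε□'s and ε◇'s from the universally assumed equation ends in an
-- equation between "erase □ first" and "insert ◇ first", which, composed into hom-sets that
-- are thin in S4_{□◇♯}, is  ε◇ ∘ □◇ε□ = ◇□ε◇ ∘ ε□ : □◇□ ⊢ ◇□◇  assumed universally.
-- That one equation lets an ε◇ and an ε□ trade places, which is exactly what separates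
-- normal forms with different spines, so all parallel arrows become equal.

module Submission where

open import Data.Empty using (⊥; ⊥-elim)
open import Data.Unit using (⊤; tt)
open import Data.List using (List; []; _∷_; _++_)
open import Data.List.Properties using (∷-injectiveʳ; ≡-dec)
open import Data.Sum using (_⊎_; inj₁; inj₂)
import Data.Sum as Sum
open import Relation.Binary.PropositionalEquality using (_≡_; _≢_; refl; sym; trans; cong)
open import Relation.Nullary using (¬_; Dec; yes; no)

open import Defs

module _ {Ax : Axioms} where

  module ≈-Reasoning where
    infix  3 _∎
    infixr 2 _≈⟨_⟩_ _≈⟨_⟨_
    infix  1 begin_

    begin_ : {A B : Mod} {f g : Term A B} → Ax ⊢ f ≈ g → Ax ⊢ f ≈ g
    begin p = p

    _≈⟨_⟩_ : {A B : Mod} (f : Term A B) {g h : Term A B} →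
             Ax ⊢ f ≈ g → Ax ⊢ g ≈ h → Ax ⊢ f ≈ h
    f ≈⟨ p ⟩ q = ≈-trans p q

    _≈⟨_⟨_ : {A B : Mod} (f : Term A B) {g h : Term A B} →
             Ax ⊢ g ≈ f → Ax ⊢ g ≈ h → Ax ⊢ f ≈ h
    f ≈⟨ p ⟨ q = ≈-trans (≈-sym p) q

    _∎ : {A B : Mod} (f : Term A B) → Ax ⊢ f ≈ f
    f ∎ = ≈-refl

  ∘-congˡ : {A B C : Mod} {g : Term B C} {f f' : Term A B} →
            Ax ⊢ f ≈ f' → Ax ⊢ (g ∘ f) ≈ (g ∘ f')
  ∘-congˡ = ∘-cong ≈-refl

  ∘-congʳ : {A B C : Mod} {g g' : Term B C} {f : Term A B} →
            Ax ⊢ g ≈ g' → Ax ⊢ (g ∘ f) ≈ (g' ∘ f)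
  ∘-congʳ p = ∘-cong p ≈-refl

  sym-assoc : {A B C D : Mod} (h : Term C D) (g : Term B C) (f : Term A B) →
              Ax ⊢ ((h ∘ g) ∘ f) ≈ (h ∘ (g ∘ f))
  sym-assoc h g f = ≈-sym (assoc h g f)

  [_]-resp-∘ : (M : Sym) {A B C : Mod} {g : Term B C} {f : Term A B} {h : Term A C} →
               Ax ⊢ (g ∘ f) ≈ h → Ax ⊢ (([ M ] g) ∘ ([ M ] f)) ≈ ([ M ] h)
  [ M ]-resp-∘ p = ≈-trans (≈-sym (M-∘ M _ _)) (M-cong M p)

-- Equations assumed universally

≈♯⇒⊢ : {Ax : Axioms} {A B : Mod} {f g : Term A B} → f ≈♯ g → Ax ⊢ f ≈ g
≈♯⇒⊢ ≈-refl          = ≈-refl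
≈♯⇒⊢ (≈-sym p)       = ≈-sym (≈♯⇒⊢ p)
≈♯⇒⊢ (≈-trans p q)   = ≈-trans (≈♯⇒⊢ p) (≈♯⇒⊢ q)
≈♯⇒⊢ (∘-cong p q)    = ∘-cong (≈♯⇒⊢ p) (≈♯⇒⊢ q)
≈♯⇒⊢ (M-cong M p)    = M-cong M (≈♯⇒⊢ p)
≈♯⇒⊢ (ax ())
≈♯⇒⊢ (idʳ f)         = idʳ f
≈♯⇒⊢ (idˡ f)         = idˡ f
≈♯⇒⊢ (assoc h g f)   = assoc h g f
≈♯⇒⊢ (M-id M A)      = M-id M A
≈♯⇒⊢ (M-∘ M g f)     = M-∘ M g f
≈♯⇒⊢ (nat-ε□ f)      = nat-ε□ f
≈♯⇒⊢ (nat-δ□□ f)     = nat-δ□□ f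
≈♯⇒⊢ (nat-ε◇ f)      = nat-ε◇ f
≈♯⇒⊢ (nat-δ◇◇ f)     = nat-δ◇◇ f
≈♯⇒⊢ (□-assoc A)     = □-assoc A
≈♯⇒⊢ (□-unitˡ A)     = □-unitˡ A
≈♯⇒⊢ (□-unitʳ A)     = □-unitʳ A
≈♯⇒⊢ (◇-assoc A)     = ◇-assoc A
≈♯⇒⊢ (◇-unitˡ A)     = ◇-unitˡ A
≈♯⇒⊢ (◇-unitʳ A)     = ◇-unitʳ A
≈♯⇒⊢ (♯□ A)          = ♯□ A
≈♯⇒⊢ (♯◇ A)          = ♯◇ A

⊲-cong : {A B : Mod} {f g : Term A B} → f ≈♯ g → (E : Mod) → (f ⊲ E) ≈♯ (g ⊲ E)
⊲-cong ≈-refl          E = ≈-refl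
⊲-cong (≈-sym p)       E = ≈-sym (⊲-cong p E)
⊲-cong (≈-trans p q)   E = ≈-trans (⊲-cong p E) (⊲-cong q E)
⊲-cong (∘-cong p q)    E = ∘-cong (⊲-cong p E) (⊲-cong q E)
⊲-cong (M-cong M p)    E = M-cong M (⊲-cong p E)
⊲-cong (ax ())         E
⊲-cong (idʳ f)         E = idʳ (f ⊲ E)
⊲-cong (idˡ f)         E = idˡ (f ⊲ E)
⊲-cong (assoc h g f)   E = assoc (h ⊲ E) (g ⊲ E) (f ⊲ E)
⊲-cong (M-id M A)      E = M-id M (A ++ E)
⊲-cong (M-∘ M g f)     E = M-∘ M (g ⊲ E) (f ⊲ E)
⊲-cong (nat-ε□ f)      E = nat-ε□ (f ⊲ E)
⊲-cong (nat-δ□□ f)     E = nat-δ□□ (f ⊲ E)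
⊲-cong (nat-ε◇ f)      E = nat-ε◇ (f ⊲ E)
⊲-cong (nat-δ◇◇ f)     E = nat-δ◇◇ (f ⊲ E)
⊲-cong (□-assoc A)     E = □-assoc (A ++ E)
⊲-cong (□-unitˡ A)     E = □-unitˡ (A ++ E)
⊲-cong (□-unitʳ A)     E = □-unitʳ (A ++ E)
⊲-cong (◇-assoc A)     E = ◇-assoc (A ++ E)
⊲-cong (◇-unitˡ A)     E = ◇-unitˡ (A ++ E)
⊲-cong (◇-unitʳ A)     E = ◇-unitʳ (A ++ E)
⊲-cong (♯□ A)          E = ♯□ (A ++ E)
⊲-cong (♯◇ A)          E = ♯◇ (A ++ E)

_⊢_≈ᵘ_ : Axioms → {A B : Mod} → Term A B → Term A B → Set
Ax ⊢ f ≈ᵘ g = (E : Mod) → Ax ⊢ (f ⊲ E) ≈ (g ⊲ E)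

module _ {Ax : Axioms} where

  ≈ᵘ-sym : {A B : Mod} {f g : Term A B} → Ax ⊢ f ≈ᵘ g → Ax ⊢ g ≈ᵘ f
  ≈ᵘ-sym p E = ≈-sym (p E)

  ≈ᵘ-resp-≈♯ : {A B : Mod} {f f' g g' : Term A B} → f ≈♯ f' → g ≈♯ g' →
               Ax ⊢ f ≈ᵘ g → Ax ⊢ f' ≈ᵘ g'
  ≈ᵘ-resp-≈♯ p q u E = ≈-trans (≈♯⇒⊢ (⊲-cong (≈-sym p) E)) (≈-trans (u E) (≈♯⇒⊢ (⊲-cong q E)))

  ∘-congˡᵘ : {A B C : Mod} (g : Term B C) {f f' : Term A B} →
             Ax ⊢ f ≈ᵘ f' → Ax ⊢ (g ∘ f) ≈ᵘ (g ∘ f')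
  ∘-congˡᵘ g p E = ∘-congˡ (p E)

  ∘-congʳᵘ : {A B C : Mod} {g g' : Term B C} (f : Term A B) →
             Ax ⊢ g ≈ᵘ g' → Ax ⊢ (g ∘ f) ≈ᵘ (g' ∘ f)
  ∘-congʳᵘ f p E = ∘-congʳ (p E)

-- Normal forms

-- Not unique: coherentₙ below identifies those with the same spine.
data Normal : Mod → Mod → Set where
  id[]    : Normal [] []
  erase□  : {A B : Mod} → Normal A B → Normal (□ ∷ A) B
  insert◇ : {A B : Mod} → Normal A B → Normal A (◇ ∷ B)
  keep□   : {A B : Mod} → Normal A B → Normal (□ ∷ A) (□ ∷ B)
  copy□   : {A B : Mod} → Normal (□ ∷ A) B → Normal (□ ∷ A) (□ ∷ B)
  keep◇   : {A B : Mod} → Normal A B → Normal (◇ ∷ A) (◇ ∷ B)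
  merge◇  : {A B : Mod} → Normal A (◇ ∷ B) → Normal (◇ ∷ A) (◇ ∷ B)

⟦_⟧ : {A B : Mod} → Normal A B → Term A B
⟦ id[] ⟧                   = 𝟙 []
⟦ erase□ {A} n ⟧           = ⟦ n ⟧ ∘ ε□ A
⟦ insert◇ {B = B} n ⟧      = ε◇ B ∘ ⟦ n ⟧
⟦ keep□ n ⟧                = [ □ ] ⟦ n ⟧
⟦ copy□ {A} n ⟧            = [ □ ] ⟦ n ⟧ ∘ δ□□ A
⟦ keep◇ n ⟧                = [ ◇ ] ⟦ n ⟧
⟦ merge◇ {B = B} n ⟧       = δ◇◇ B ∘ [ ◇ ] ⟦ n ⟧

spine : {A B : Mod} → Normal A B → List Sym
spine id[]        = []
spine (erase□ n)  = spine n
spine (insert◇ n) = spine n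
spine (keep□ n)   = □ ∷ spine n
spine (copy□ n)   = □ ∷ spine n
spine (keep◇ n)   = ◇ ∷ spine n
spine (merge◇ n)  = ◇ ∷ spine n

idₙ : (A : Mod) → Normal A A
idₙ []      = id[]
idₙ (□ ∷ A) = keep□ (idₙ A)
idₙ (◇ ∷ A) = keep◇ (idₙ A)

postε□ : {A B : Mod} → Normal A (□ ∷ B) → Normal A B
postε□ (erase□ n) = erase□ (postε□ n)
postε□ (keep□ n)  = erase□ n
postε□ (copy□ n)  = n

postδ□□ : {A B : Mod} → Normal A (□ ∷ B) → Normal A (□ ∷ □ ∷ B)
postδ□□ (erase□ n) = erase□ (postδ□□ n)
postδ□□ (keep□ n)  = copy□ (keep□ n)
postδ□□ (copy□ n)  = copy□ (copy□ n)

postδ◇◇ : {A B : Mod} → Normal A (◇ ∷ ◇ ∷ B) → Normal A (◇ ∷ B)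
postδ◇◇ (erase□ n)  = erase□ (postδ◇◇ n)
postδ◇◇ (insert◇ n) = n
postδ◇◇ (keep◇ n)   = merge◇ n
postδ◇◇ (merge◇ n)  = merge◇ (postδ◇◇ n)

mutual
  post : {A B C : Mod} → Term B C → Normal A B → Normal A C
  post (𝟙 _)     n = n
  post (ε□ _)    n = postε□ n
  post (δ□□ _)   n = postδ□□ n
  post (ε◇ _)    n = insert◇ n
  post (δ◇◇ _)   n = postδ◇◇ n
  post (g ∘ f)   n = post g (post f n)
  post ([ M ] g) n = post[ M ] g n

  post[_] : {A B C : Mod} (M : Sym) → Term B C → Normal A (M ∷ B) → Normal A (M ∷ C)
  post[ M ] g (erase□ n)  = erase□ (post[ M ] g n)
  post[ ◇ ] g (insert◇ n) = insert◇ (post g n)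
  post[ □ ] g (keep□ n)   = keep□ (post g n)
  post[ □ ] g (copy□ n)   = copy□ (post g n)
  post[ ◇ ] g (keep◇ n)   = keep◇ (post g n)
  post[ ◇ ] g (merge◇ n)  = merge◇ (post[ ◇ ] g n)

normalise : {A B : Mod} → Term A B → Normal A B
normalise {A} f = post f (idₙ A)

preε◇ : {A B : Mod} → Normal (◇ ∷ A) B → Normal A B
preε◇ (insert◇ n) = insert◇ (preε◇ n)
preε◇ (keep◇ n)   = insert◇ n
preε◇ (merge◇ n)  = n

spine-postε□ : {A B : Mod} (n : Normal A (□ ∷ B)) → spine n ≡ □ ∷ spine (postε□ n)
spine-postε□ (erase□ n) = spine-postε□ n
spine-postε□ (keep□ n)  = refl
spine-postε□ (copy□ n)  = refl

spine-preε◇ : {A B : Mod} (n : Normal (◇ ∷ A) B) → spine n ≡ ◇ ∷ spine (preε◇ n)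
spine-preε◇ (insert◇ n) = spine-preε◇ n
spine-preε◇ (keep◇ n)   = refl
spine-preε◇ (merge◇ n)  = refl

spine-postε□-≢ : {A B : Mod} (n₁ n₂ : Normal A (□ ∷ B)) →
                 spine n₁ ≢ spine n₂ → spine (postε□ n₁) ≢ spine (postε□ n₂)
spine-postε□-≢ n₁ n₂ ne e = ne (trans (spine-postε□ n₁) (trans (cong (□ ∷_) e) (sym (spine-postε□ n₂))))

spine-preε◇-≢ : {A B : Mod} (n₁ n₂ : Normal (◇ ∷ A) B) →
                spine n₁ ≢ spine n₂ → spine (preε◇ n₁) ≢ spine (preε◇ n₂)
spine-preε◇-≢ n₁ n₂ ne e = ne (trans (spine-preε◇ n₁) (trans (cong (◇ ∷_) e) (sym (spine-preε◇ n₂))))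

spine-from[] : {B : Mod} (n : Normal [] B) → spine n ≡ []
spine-from[] id[]        = refl
spine-from[] (insert◇ n) = spine-from[] n

spine-to[] : {A : Mod} (n : Normal A []) → spine n ≡ []
spine-to[] id[]       = refl
spine-to[] (erase□ n) = spine-to[] n

module _ {Ax : Axioms} where
  open ≈-Reasoning

  postε□-sound : {A B : Mod} (n : Normal A (□ ∷ B)) → Ax ⊢ ⟦ postε□ n ⟧ ≈ (ε□ B ∘ ⟦ n ⟧)
  postε□-sound {B = B} (erase□ {A} n) = begin
    ⟦ postε□ n ⟧ ∘ ε□ A       ≈⟨ ∘-congʳ (postε□-sound n) ⟩
    (ε□ B ∘ ⟦ n ⟧) ∘ ε□ A     ≈⟨ sym-assoc _ _ _ ⟩
    ε□ B ∘ (⟦ n ⟧ ∘ ε□ A)     ∎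
  postε□-sound (keep□ n) = nat-ε□ ⟦ n ⟧
  postε□-sound {B = B} (copy□ {A} n) = begin
    ⟦ n ⟧                                ≈⟨ idʳ _ ⟨
    ⟦ n ⟧ ∘ 𝟙 _                          ≈⟨ ∘-congˡ (□-unitˡ A) ⟨
    ⟦ n ⟧ ∘ (ε□ (□ ∷ A) ∘ δ□□ A)         ≈⟨ assoc _ _ _ ⟩
    (⟦ n ⟧ ∘ ε□ (□ ∷ A)) ∘ δ□□ A         ≈⟨ ∘-congʳ (nat-ε□ ⟦ n ⟧) ⟩
    (ε□ B ∘ [ □ ] ⟦ n ⟧) ∘ δ□□ A         ≈⟨ sym-assoc _ _ _ ⟩
    ε□ B ∘ ([ □ ] ⟦ n ⟧ ∘ δ□□ A)         ∎

  postδ□□-sound : {A B : Mod} (n : Normal A (□ ∷ B)) → Ax ⊢ ⟦ postδ□□ n ⟧ ≈ (δ□□ B ∘ ⟦ n ⟧)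
  postδ□□-sound {B = B} (erase□ {A} n) = begin
    ⟦ postδ□□ n ⟧ ∘ ε□ A      ≈⟨ ∘-congʳ (postδ□□-sound n) ⟩
    (δ□□ B ∘ ⟦ n ⟧) ∘ ε□ A    ≈⟨ sym-assoc _ _ _ ⟩
    δ□□ B ∘ (⟦ n ⟧ ∘ ε□ A)    ∎
  postδ□□-sound (keep□ n) = nat-δ□□ ⟦ n ⟧
  postδ□□-sound {B = B} (copy□ {A} n) = begin
    [ □ ] ([ □ ] ⟦ n ⟧ ∘ δ□□ A) ∘ δ□□ A              ≈⟨ ∘-congʳ (M-∘ □ _ _) ⟩
    ([ □ ] [ □ ] ⟦ n ⟧ ∘ [ □ ] δ□□ A) ∘ δ□□ A        ≈⟨ sym-assoc _ _ _ ⟩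
    [ □ ] [ □ ] ⟦ n ⟧ ∘ ([ □ ] δ□□ A ∘ δ□□ A)        ≈⟨ ∘-congˡ (□-assoc A) ⟩
    [ □ ] [ □ ] ⟦ n ⟧ ∘ (δ□□ (□ ∷ A) ∘ δ□□ A)        ≈⟨ assoc _ _ _ ⟩
    ([ □ ] [ □ ] ⟦ n ⟧ ∘ δ□□ (□ ∷ A)) ∘ δ□□ A        ≈⟨ ∘-congʳ (nat-δ□□ ⟦ n ⟧) ⟩
    (δ□□ B ∘ [ □ ] ⟦ n ⟧) ∘ δ□□ A                    ≈⟨ sym-assoc _ _ _ ⟩
    δ□□ B ∘ ([ □ ] ⟦ n ⟧ ∘ δ□□ A)                    ∎

  postδ◇◇-sound : {A B : Mod} (n : Normal A (◇ ∷ ◇ ∷ B)) → Ax ⊢ ⟦ postδ◇◇ n ⟧ ≈ (δ◇◇ B ∘ ⟦ n ⟧)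
  postδ◇◇-sound {B = B} (erase□ {A} n) = begin
    ⟦ postδ◇◇ n ⟧ ∘ ε□ A      ≈⟨ ∘-congʳ (postδ◇◇-sound n) ⟩
    (δ◇◇ B ∘ ⟦ n ⟧) ∘ ε□ A    ≈⟨ sym-assoc _ _ _ ⟩
    δ◇◇ B ∘ (⟦ n ⟧ ∘ ε□ A)    ∎
  postδ◇◇-sound {B = B} (insert◇ n) = begin
    ⟦ n ⟧                                ≈⟨ idˡ _ ⟨
    𝟙 _ ∘ ⟦ n ⟧                          ≈⟨ ∘-congʳ (◇-unitˡ B) ⟨
    (δ◇◇ B ∘ ε◇ (◇ ∷ B)) ∘ ⟦ n ⟧         ≈⟨ sym-assoc _ _ _ ⟩
    δ◇◇ B ∘ (ε◇ (◇ ∷ B) ∘ ⟦ n ⟧)         ∎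
  postδ◇◇-sound (keep◇ n) = ≈-refl
  postδ◇◇-sound {B = B} (merge◇ n) = begin
    δ◇◇ B ∘ [ ◇ ] ⟦ postδ◇◇ n ⟧                  ≈⟨ ∘-congˡ (M-cong ◇ (postδ◇◇-sound n)) ⟩
    δ◇◇ B ∘ [ ◇ ] (δ◇◇ B ∘ ⟦ n ⟧)                ≈⟨ ∘-congˡ (M-∘ ◇ _ _) ⟩
    δ◇◇ B ∘ ([ ◇ ] δ◇◇ B ∘ [ ◇ ] ⟦ n ⟧)          ≈⟨ assoc _ _ _ ⟩
    (δ◇◇ B ∘ [ ◇ ] δ◇◇ B) ∘ [ ◇ ] ⟦ n ⟧          ≈⟨ ∘-congʳ (◇-assoc B) ⟩
    (δ◇◇ B ∘ δ◇◇ (◇ ∷ B)) ∘ [ ◇ ] ⟦ n ⟧          ≈⟨ sym-assoc _ _ _ ⟩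
    δ◇◇ B ∘ (δ◇◇ (◇ ∷ B) ∘ [ ◇ ] ⟦ n ⟧)          ∎

  mutual
    post-sound : {A B C : Mod} (g : Term B C) (n : Normal A B) → Ax ⊢ ⟦ post g n ⟧ ≈ (g ∘ ⟦ n ⟧)
    post-sound (𝟙 _)     n = ≈-sym (idˡ _)
    post-sound (ε□ _)    n = postε□-sound n
    post-sound (δ□□ _)   n = postδ□□-sound n
    post-sound (ε◇ _)    n = ≈-refl
    post-sound (δ◇◇ _)   n = postδ◇◇-sound n
    post-sound (g ∘ f)   n = begin
      ⟦ post g (post f n) ⟧     ≈⟨ post-sound g (post f n) ⟩
      g ∘ ⟦ post f n ⟧          ≈⟨ ∘-congˡ (post-sound f n) ⟩
      g ∘ (f ∘ ⟦ n ⟧)           ≈⟨ assoc _ _ _ ⟩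
      (g ∘ f) ∘ ⟦ n ⟧           ∎
    post-sound ([ M ] g) n = post[ M ]-sound g n

    post[_]-sound : {A B C : Mod} (M : Sym) (g : Term B C) (n : Normal A (M ∷ B)) →
                    Ax ⊢ ⟦ post[ M ] g n ⟧ ≈ ([ M ] g ∘ ⟦ n ⟧)
    post[ M ]-sound g (erase□ {A} n) = begin
      ⟦ post[ M ] g n ⟧ ∘ ε□ A      ≈⟨ ∘-congʳ (post[ M ]-sound g n) ⟩
      ([ M ] g ∘ ⟦ n ⟧) ∘ ε□ A      ≈⟨ sym-assoc _ _ _ ⟩
      [ M ] g ∘ (⟦ n ⟧ ∘ ε□ A)      ∎
    post[ ◇ ]-sound g (insert◇ {B = B} n) = begin
      ε◇ _ ∘ ⟦ post g n ⟧           ≈⟨ ∘-congˡ (post-sound g n) ⟩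
      ε◇ _ ∘ (g ∘ ⟦ n ⟧)            ≈⟨ assoc _ _ _ ⟩
      (ε◇ _ ∘ g) ∘ ⟦ n ⟧            ≈⟨ ∘-congʳ (nat-ε◇ g) ⟨
      ([ ◇ ] g ∘ ε◇ B) ∘ ⟦ n ⟧      ≈⟨ sym-assoc _ _ _ ⟩
      [ ◇ ] g ∘ (ε◇ B ∘ ⟦ n ⟧)      ∎
    post[ □ ]-sound g (keep□ n) = ≈-trans (M-cong □ (post-sound g n)) (M-∘ □ _ _)
    post[ □ ]-sound g (copy□ {A} n) = begin
      [ □ ] ⟦ post g n ⟧ ∘ δ□□ A             ≈⟨ ∘-congʳ (M-cong □ (post-sound g n)) ⟩
      [ □ ] (g ∘ ⟦ n ⟧) ∘ δ□□ A              ≈⟨ ∘-congʳ (M-∘ □ _ _) ⟩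
      ([ □ ] g ∘ [ □ ] ⟦ n ⟧) ∘ δ□□ A        ≈⟨ sym-assoc _ _ _ ⟩
      [ □ ] g ∘ ([ □ ] ⟦ n ⟧ ∘ δ□□ A)        ∎
    post[ ◇ ]-sound g (keep◇ n) = ≈-trans (M-cong ◇ (post-sound g n)) (M-∘ ◇ _ _)
    post[ ◇ ]-sound g (merge◇ {B = B} n) = begin
      δ◇◇ _ ∘ [ ◇ ] ⟦ post[ ◇ ] g n ⟧            ≈⟨ ∘-congˡ (M-cong ◇ (post[ ◇ ]-sound g n)) ⟩
      δ◇◇ _ ∘ [ ◇ ] ([ ◇ ] g ∘ ⟦ n ⟧)            ≈⟨ ∘-congˡ (M-∘ ◇ _ _) ⟩
      δ◇◇ _ ∘ ([ ◇ ] [ ◇ ] g ∘ [ ◇ ] ⟦ n ⟧)      ≈⟨ assoc _ _ _ ⟩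
      (δ◇◇ _ ∘ [ ◇ ] [ ◇ ] g) ∘ [ ◇ ] ⟦ n ⟧      ≈⟨ ∘-congʳ (nat-δ◇◇ g) ⟨
      ([ ◇ ] g ∘ δ◇◇ B) ∘ [ ◇ ] ⟦ n ⟧            ≈⟨ sym-assoc _ _ _ ⟩
      [ ◇ ] g ∘ (δ◇◇ B ∘ [ ◇ ] ⟦ n ⟧)            ∎

  idₙ-sound : (A : Mod) → Ax ⊢ ⟦ idₙ A ⟧ ≈ 𝟙 A
  idₙ-sound []      = ≈-refl
  idₙ-sound (□ ∷ A) = ≈-trans (M-cong □ (idₙ-sound A)) (M-id □ A)
  idₙ-sound (◇ ∷ A) = ≈-trans (M-cong ◇ (idₙ-sound A)) (M-id ◇ A)

  normalise-sound : {A B : Mod} (f : Term A B) → Ax ⊢ f ≈ ⟦ normalise f ⟧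
  normalise-sound {A} f = begin
    f                         ≈⟨ idʳ f ⟨
    f ∘ 𝟙 A                   ≈⟨ ∘-congˡ (idₙ-sound A) ⟨
    f ∘ ⟦ idₙ A ⟧             ≈⟨ post-sound f (idₙ A) ⟨
    ⟦ normalise f ⟧           ∎

  preε◇-sound : {A B : Mod} (n : Normal (◇ ∷ A) B) → Ax ⊢ ⟦ preε◇ n ⟧ ≈ (⟦ n ⟧ ∘ ε◇ A)
  preε◇-sound {A} (insert◇ {B = B} n) = begin
    ε◇ B ∘ ⟦ preε◇ n ⟧        ≈⟨ ∘-congˡ (preε◇-sound n) ⟩
    ε◇ B ∘ (⟦ n ⟧ ∘ ε◇ A)     ≈⟨ assoc _ _ _ ⟩
    (ε◇ B ∘ ⟦ n ⟧) ∘ ε◇ A     ∎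
  preε◇-sound (keep◇ n) = ≈-sym (nat-ε◇ ⟦ n ⟧)
  preε◇-sound {A} (merge◇ {B = B} n) = begin
    ⟦ n ⟧                                ≈⟨ idˡ _ ⟨
    𝟙 _ ∘ ⟦ n ⟧                          ≈⟨ ∘-congʳ (◇-unitˡ B) ⟨
    (δ◇◇ B ∘ ε◇ (◇ ∷ B)) ∘ ⟦ n ⟧         ≈⟨ sym-assoc _ _ _ ⟩
    δ◇◇ B ∘ (ε◇ (◇ ∷ B) ∘ ⟦ n ⟧)         ≈⟨ ∘-congˡ (nat-ε◇ ⟦ n ⟧) ⟨
    δ◇◇ B ∘ ([ ◇ ] ⟦ n ⟧ ∘ ε◇ A)         ≈⟨ assoc _ _ _ ⟩
    (δ◇◇ B ∘ [ ◇ ] ⟦ n ⟧) ∘ ε◇ A         ∎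

-- Coherence on alternating modalities

outer◇ outer□ : Term (□ ∷ ◇ ∷ □ ∷ []) (◇ ∷ □ ∷ ◇ ∷ [])
outer◇ = ε◇ (□ ∷ ◇ ∷ []) ∘ [ □ ] [ ◇ ] ε□ []
outer□ = [ ◇ ] [ □ ] ε◇ [] ∘ ε□ (◇ ∷ □ ∷ [])

-- Every new equation implies this one (collapse), and it implies every equation (coherent).
Collapses : Axioms → Set
Collapses Ax = Ax ⊢ outer◇ ≈ᵘ outer□

HeadDiffers : Sym → Mod → Set
HeadDiffers □ (□ ∷ _) = ⊥
HeadDiffers ◇ (◇ ∷ _) = ⊥
HeadDiffers _ _       = ⊤

data Alternating : Mod → Set where
  []  : Alternating []
  alt : {M : Sym} {A : Mod} → Alternating A → HeadDiffers M A → Alternating (M ∷ A)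

¬□-target : {A B : Mod} → Alternating (□ ∷ A) → ¬ Normal A (□ ∷ B)
¬□-target (alt _ ()) (erase□ _)
¬□-target (alt _ ()) (keep□ _)
¬□-target (alt _ ()) (copy□ _)

¬◇-source : {A B : Mod} → Alternating (◇ ∷ B) → ¬ Normal (◇ ∷ A) B
¬◇-source (alt _ ()) (insert◇ _)
¬◇-source (alt _ ()) (keep◇ _)
¬◇-source (alt _ ()) (merge◇ _)

module _ {Ax : Axioms} where
  open ≈-Reasoning

  []-via-δ□□ : {A B : Mod} (f : Term A B) → Ax ⊢ [ □ ] f ≈ ([ □ ] (f ∘ ε□ A) ∘ δ□□ A)
  []-via-δ□□ {A} f = begin
    [ □ ] f                                ≈⟨ idʳ _ ⟨
    [ □ ] f ∘ 𝟙 _                          ≈⟨ ∘-congˡ (□-unitʳ A) ⟨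
    [ □ ] f ∘ ([ □ ] ε□ A ∘ δ□□ A)         ≈⟨ assoc _ _ _ ⟩
    ([ □ ] f ∘ [ □ ] ε□ A) ∘ δ□□ A         ≈⟨ ∘-congʳ (M-∘ □ _ _) ⟨
    [ □ ] (f ∘ ε□ A) ∘ δ□□ A               ∎

  []-via-δ◇◇ : {A B : Mod} (f : Term A B) → Ax ⊢ [ ◇ ] f ≈ (δ◇◇ B ∘ [ ◇ ] (ε◇ B ∘ f))
  []-via-δ◇◇ {B = B} f = begin
    [ ◇ ] f                                ≈⟨ idˡ _ ⟨
    𝟙 _ ∘ [ ◇ ] f                          ≈⟨ ∘-congʳ (◇-unitʳ B) ⟨
    (δ◇◇ B ∘ [ ◇ ] ε◇ B) ∘ [ ◇ ] f         ≈⟨ sym-assoc _ _ _ ⟩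
    δ◇◇ B ∘ ([ ◇ ] ε◇ B ∘ [ ◇ ] f)         ≈⟨ ∘-congˡ (M-∘ ◇ _ _) ⟨
    δ◇◇ B ∘ [ ◇ ] (ε◇ B ∘ f)               ∎

  erase□-insert◇ : {A B : Mod} (n : Normal A B) → Ax ⊢ ⟦ erase□ (insert◇ n) ⟧ ≈ ⟦ insert◇ (erase□ n) ⟧
  erase□-insert◇ n = sym-assoc _ _ _

  -- Collapses at □ ∷ A, preceded by □◇δ□□ and followed by ◇ f.
  collapse-ε◇∘ : Collapses Ax → {A B : Mod} (f : Term (□ ∷ ◇ ∷ □ ∷ A) (□ ∷ B)) →
                 Ax ⊢ (ε◇ (□ ∷ B) ∘ f) ≈ (([ ◇ ] (f ∘ [ □ ] ε◇ (□ ∷ A)) ∘ [ ◇ ] δ□□ A) ∘ ε□ (◇ ∷ □ ∷ A))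
  collapse-ε◇∘ c {A} {B} f = begin
    ε◇ (□ ∷ B) ∘ f                                      ≈⟨ outer◇-instance ⟨
    [ ◇ ] f ∘ ((outer◇ ⊲ (□ ∷ A)) ∘ [ □ ] [ ◇ ] δ□□ A)  ≈⟨ ∘-congˡ (∘-congʳ (c (□ ∷ A))) ⟩
    [ ◇ ] f ∘ ((outer□ ⊲ (□ ∷ A)) ∘ [ □ ] [ ◇ ] δ□□ A)  ≈⟨ outer□-instance ⟩
    ([ ◇ ] (f ∘ [ □ ] ε◇ (□ ∷ A)) ∘ [ ◇ ] δ□□ A) ∘ ε□ (◇ ∷ □ ∷ A) ∎
    where
    X = □ ∷ A
    retraction : Ax ⊢ ([ □ ] [ ◇ ] ε□ X ∘ [ □ ] [ ◇ ] δ□□ A) ≈ 𝟙 (□ ∷ ◇ ∷ X)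
    retraction = begin
      [ □ ] [ ◇ ] ε□ X ∘ [ □ ] [ ◇ ] δ□□ A    ≈⟨ [ □ ]-resp-∘ ([ ◇ ]-resp-∘ (□-unitˡ A)) ⟩
      [ □ ] [ ◇ ] 𝟙 X                        ≈⟨ M-cong □ (M-id ◇ X) ⟩
      [ □ ] 𝟙 (◇ ∷ X)                        ≈⟨ M-id □ (◇ ∷ X) ⟩
      𝟙 (□ ∷ ◇ ∷ X)                          ∎
    outer◇-instance : Ax ⊢ ([ ◇ ] f ∘ ((outer◇ ⊲ X) ∘ [ □ ] [ ◇ ] δ□□ A)) ≈ (ε◇ (□ ∷ B) ∘ f)
    outer◇-instance = begin
      [ ◇ ] f ∘ ((ε◇ (□ ∷ ◇ ∷ X) ∘ [ □ ] [ ◇ ] ε□ X) ∘ [ □ ] [ ◇ ] δ□□ A)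
        ≈⟨ ∘-congˡ (sym-assoc _ _ _) ⟩
      [ ◇ ] f ∘ (ε◇ (□ ∷ ◇ ∷ X) ∘ ([ □ ] [ ◇ ] ε□ X ∘ [ □ ] [ ◇ ] δ□□ A))
        ≈⟨ ∘-congˡ (∘-congˡ retraction) ⟩
      [ ◇ ] f ∘ (ε◇ (□ ∷ ◇ ∷ X) ∘ 𝟙 _)        ≈⟨ ∘-congˡ (idʳ _) ⟩
      [ ◇ ] f ∘ ε◇ (□ ∷ ◇ ∷ X)                ≈⟨ nat-ε◇ f ⟩
      ε◇ (□ ∷ B) ∘ f                          ∎
    outer□-instance : Ax ⊢ ([ ◇ ] f ∘ ((outer□ ⊲ X) ∘ [ □ ] [ ◇ ] δ□□ A)) ≈
                      (([ ◇ ] (f ∘ [ □ ] ε◇ X) ∘ [ ◇ ] δ□□ A) ∘ ε□ (◇ ∷ □ ∷ A))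
    outer□-instance = begin
      [ ◇ ] f ∘ (([ ◇ ] [ □ ] ε◇ X ∘ ε□ (◇ ∷ □ ∷ X)) ∘ [ □ ] [ ◇ ] δ□□ A)
        ≈⟨ ∘-congˡ (sym-assoc _ _ _) ⟩
      [ ◇ ] f ∘ ([ ◇ ] [ □ ] ε◇ X ∘ (ε□ (◇ ∷ □ ∷ X) ∘ [ □ ] [ ◇ ] δ□□ A))
        ≈⟨ ∘-congˡ (∘-congˡ (nat-ε□ ([ ◇ ] δ□□ A))) ⟨
      [ ◇ ] f ∘ ([ ◇ ] [ □ ] ε◇ X ∘ ([ ◇ ] δ□□ A ∘ ε□ (◇ ∷ □ ∷ A)))
        ≈⟨ ∘-congˡ (assoc _ _ _) ⟩
      [ ◇ ] f ∘ (([ ◇ ] [ □ ] ε◇ X ∘ [ ◇ ] δ□□ A) ∘ ε□ (◇ ∷ □ ∷ A))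
        ≈⟨ assoc _ _ _ ⟩
      ([ ◇ ] f ∘ ([ ◇ ] [ □ ] ε◇ X ∘ [ ◇ ] δ□□ A)) ∘ ε□ (◇ ∷ □ ∷ A)
        ≈⟨ ∘-congʳ (assoc _ _ _) ⟩
      (([ ◇ ] f ∘ [ ◇ ] [ □ ] ε◇ X) ∘ [ ◇ ] δ□□ A) ∘ ε□ (◇ ∷ □ ∷ A)
        ≈⟨ ∘-congʳ (∘-congʳ (M-∘ ◇ _ _)) ⟨
      ([ ◇ ] (f ∘ [ □ ] ε◇ X) ∘ [ ◇ ] δ□□ A) ∘ ε□ (◇ ∷ □ ∷ A) ∎

spine-◇≢□ : {A B C D : Mod} (n₁ : Normal (◇ ∷ A) B) (n₂ : Normal C (□ ∷ D)) → spine n₁ ≢ spine n₂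
spine-◇≢□ n₁ n₂ e with trans (sym (spine-preε◇ n₁)) (trans e (spine-postε□ n₂))
... | ()

¬◇-to-◇□ : {B : Mod} → ¬ Normal (◇ ∷ []) (◇ ∷ □ ∷ B)
¬◇-to-◇□ (insert◇ ())
¬◇-to-◇□ (keep◇ ())
¬◇-to-◇□ (merge◇ (insert◇ ()))

module _ {Ax : Axioms} where
  open ≈-Reasoning

  mutual
    coherentₙ : {A B : Mod} → Alternating A → Alternating B → (n₁ n₂ : Normal A B) →
               Collapses Ax ⊎ spine n₁ ≡ spine n₂ → Ax ⊢ ⟦ n₁ ⟧ ≈ ⟦ n₂ ⟧
    coherentₙ a b id[] id[] h = ≈-refl
    coherentₙ (alt a _) b (erase□ n₁) (erase□ n₂) h = ∘-congʳ (coherentₙ a b n₁ n₂ h)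
    coherentₙ a b (erase□ n₁) (insert◇ n₂) h = coherentₙ-erase□-insert◇ a b n₁ n₂ h
    coherentₙ a b (erase□ n₁) (keep□ n₂) h = ⊥-elim (¬□-target a n₁)
    coherentₙ a b (erase□ n₁) (copy□ n₂) h = ⊥-elim (¬□-target a n₁)
    coherentₙ a b (insert◇ n₁) (erase□ n₂) h =
      ≈-sym (coherentₙ-erase□-insert◇ a b n₂ n₁ (Sum.map₂ sym h))
    coherentₙ a (alt b _) (insert◇ n₁) (insert◇ n₂) h = ∘-congˡ (coherentₙ a b n₁ n₂ h)
    coherentₙ a b (insert◇ n₁) (keep◇ n₂) h = ⊥-elim (¬◇-source b n₁)
    coherentₙ a b (insert◇ n₁) (merge◇ n₂) h = ⊥-elim (¬◇-source b n₁)
    coherentₙ a b (keep□ n₁) (erase□ n₂) h = ⊥-elim (¬□-target a n₂)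
    coherentₙ (alt a _) (alt b _) (keep□ n₁) (keep□ n₂) h =
      M-cong □ (coherentₙ a b n₁ n₂ (Sum.map₂ ∷-injectiveʳ h))
    coherentₙ a b (keep□ n₁) (copy□ n₂) h = coherentₙ-keep□-copy□ a b n₁ n₂ h
    coherentₙ a b (copy□ n₁) (erase□ n₂) h = ⊥-elim (¬□-target a n₂)
    coherentₙ a b (copy□ n₁) (keep□ n₂) h = ≈-sym (coherentₙ-keep□-copy□ a b n₂ n₁ (Sum.map₂ sym h))
    coherentₙ a (alt b _) (copy□ n₁) (copy□ n₂) h =
      ∘-congʳ (M-cong □ (coherentₙ a b n₁ n₂ (Sum.map₂ ∷-injectiveʳ h)))
    coherentₙ a b (keep◇ n₁) (insert◇ n₂) h = ⊥-elim (¬◇-source b n₂)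
    coherentₙ (alt a _) (alt b _) (keep◇ n₁) (keep◇ n₂) h =
      M-cong ◇ (coherentₙ a b n₁ n₂ (Sum.map₂ ∷-injectiveʳ h))
    coherentₙ a b (keep◇ n₁) (merge◇ n₂) h = coherentₙ-keep◇-merge◇ a b n₁ n₂ h
    coherentₙ a b (merge◇ n₁) (insert◇ n₂) h = ⊥-elim (¬◇-source b n₂)
    coherentₙ a b (merge◇ n₁) (keep◇ n₂) h =
      ≈-sym (coherentₙ-keep◇-merge◇ a b n₂ n₁ (Sum.map₂ sym h))
    coherentₙ (alt a _) b (merge◇ n₁) (merge◇ n₂) h =
      ∘-congˡ (M-cong ◇ (coherentₙ a b n₁ n₂ (Sum.map₂ ∷-injectiveʳ h)))

    coherentₙ-keep□-copy□ : {A B : Mod} → Alternating (□ ∷ A) → Alternating (□ ∷ B) →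
      (n₁ : Normal A B) (n₂ : Normal (□ ∷ A) B) →
      Collapses Ax ⊎ spine (keep□ n₁) ≡ spine (copy□ n₂) → Ax ⊢ ⟦ keep□ n₁ ⟧ ≈ ⟦ copy□ n₂ ⟧
    coherentₙ-keep□-copy□ a (alt b _) n₁ n₂ h = ≈-trans ([]-via-δ□□ ⟦ n₁ ⟧)
      (∘-congʳ (M-cong □ (coherentₙ a b (erase□ n₁) n₂ (Sum.map₂ ∷-injectiveʳ h))))

    coherentₙ-keep◇-merge◇ : {A B : Mod} → Alternating (◇ ∷ A) → Alternating (◇ ∷ B) →
      (n₁ : Normal A B) (n₂ : Normal A (◇ ∷ B)) →
      Collapses Ax ⊎ spine (keep◇ n₁) ≡ spine (merge◇ n₂) → Ax ⊢ ⟦ keep◇ n₁ ⟧ ≈ ⟦ merge◇ n₂ ⟧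
    coherentₙ-keep◇-merge◇ (alt a _) b n₁ n₂ h = ≈-trans ([]-via-δ◇◇ ⟦ n₁ ⟧)
      (∘-congˡ (M-cong ◇ (coherentₙ a b (insert◇ n₁) n₂ (Sum.map₂ ∷-injectiveʳ h))))

    coherentₙ-erase□-insert◇ : {A B : Mod} → Alternating (□ ∷ A) → Alternating (◇ ∷ B) →
      (n₁ : Normal A (◇ ∷ B)) (n₂ : Normal (□ ∷ A) B) →
      Collapses Ax ⊎ spine n₁ ≡ spine n₂ → Ax ⊢ ⟦ erase□ n₁ ⟧ ≈ ⟦ insert◇ n₂ ⟧
    coherentₙ-erase□-insert◇ (alt _ ()) b (erase□ n₁) n₂ h
    coherentₙ-erase□-insert◇ a (alt b _) (insert◇ n₁) n₂ h =
      ≈-trans (erase□-insert◇ n₁) (∘-congˡ (coherentₙ a b (erase□ n₁) n₂ h))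
    coherentₙ-erase□-insert◇ (alt a _) b n₁@(keep◇ _) (erase□ n₂) h =
      ≈-trans (∘-congʳ (coherentₙ a b n₁ (insert◇ n₂) h)) (erase□-insert◇ n₂)
    coherentₙ-erase□-insert◇ (alt a _) b n₁@(merge◇ _) (erase□ n₂) h =
      ≈-trans (∘-congʳ (coherentₙ a b n₁ (insert◇ n₂) h)) (erase□-insert◇ n₂)
    coherentₙ-erase□-insert◇ a (alt _ ()) (keep◇ n₁) (insert◇ n₂) h
    coherentₙ-erase□-insert◇ a (alt _ ()) (merge◇ n₁) (insert◇ n₂) h
    coherentₙ-erase□-insert◇ a b n₁@(keep◇ _) n₂@(keep□ _) h = coherentₙ-across a b n₁ n₂ h
    coherentₙ-erase□-insert◇ a b n₁@(keep◇ _) n₂@(copy□ _) h = coherentₙ-across a b n₁ n₂ h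
    coherentₙ-erase□-insert◇ a b n₁@(merge◇ _) n₂@(keep□ _) h = coherentₙ-across a b n₁ n₂ h
    coherentₙ-erase□-insert◇ a b n₁@(merge◇ _) n₂@(copy□ _) h = coherentₙ-across a b n₁ n₂ h

    -- The spines differ here, so only the collapsed equation can identify the two sides.
    coherentₙ-across : {A B : Mod} → Alternating (□ ∷ ◇ ∷ A) → Alternating (◇ ∷ □ ∷ B) →
      (n₁ : Normal (◇ ∷ A) (◇ ∷ □ ∷ B)) (n₂ : Normal (□ ∷ ◇ ∷ A) (□ ∷ B)) →
      Collapses Ax ⊎ spine n₁ ≡ spine n₂ → Ax ⊢ ⟦ erase□ n₁ ⟧ ≈ ⟦ insert◇ n₂ ⟧
    coherentₙ-across a b n₁ n₂ (inj₂ e) = ⊥-elim (spine-◇≢□ n₁ n₂ e)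
    coherentₙ-across {[]} a b n₁ n₂ (inj₁ c) = ⊥-elim (¬◇-to-◇□ n₁)
    coherentₙ-across {◇ ∷ A} (alt (alt _ ()) _) b n₁ n₂ (inj₁ c)
    coherentₙ-across {□ ∷ A} {B} (alt a _) b n₁ n₂ (inj₁ c) = ≈-sym (begin
      ε◇ _ ∘ ⟦ n₂ ⟧                    ≈⟨ collapse-ε◇∘ c ⟦ n₂ ⟧ ⟩
      f ∘ ε□ (◇ ∷ □ ∷ A)               ≈⟨ ∘-congʳ (normalise-sound f) ⟩
      ⟦ normalise f ⟧ ∘ ε□ (◇ ∷ □ ∷ A) ≈⟨ ∘-congʳ (coherentₙ a b (normalise f) n₁ (inj₁ c)) ⟩
      ⟦ n₁ ⟧ ∘ ε□ (◇ ∷ □ ∷ A)          ∎)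
      where
      f : Term (◇ ∷ □ ∷ A) (◇ ∷ □ ∷ B)
      f = [ ◇ ] (⟦ n₂ ⟧ ∘ [ □ ] ε◇ (□ ∷ A)) ∘ [ ◇ ] δ□□ A

coherent : {Ax : Axioms} {A B : Mod} → Alternating A → Alternating B → (f g : Term A B) →
           Collapses Ax ⊎ spine (normalise f) ≡ spine (normalise g) → Ax ⊢ f ≈ g
coherent a b f g h =
  ≈-trans (normalise-sound f)
    (≈-trans (coherentₙ a b (normalise f) (normalise g) h) (≈-sym (normalise-sound g)))

-- Distinct spines force the collapse

spine-□→◇ : (n : Normal (□ ∷ []) (◇ ∷ [])) → spine n ≡ []
spine-□→◇ (erase□ n)  = spine-from[] n
spine-□→◇ (insert◇ n) = spine-to[] n

spine-◇□→◇□◇ : (n : Normal (◇ ∷ □ ∷ []) (◇ ∷ □ ∷ ◇ ∷ [])) → spine n ≡ ◇ ∷ □ ∷ []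
spine-◇□→◇□◇ (insert◇ ())
spine-◇□→◇□◇ (keep◇ (erase□ ()))
spine-◇□→◇□◇ (keep◇ (keep□ n))             = cong (λ s → ◇ ∷ □ ∷ s) (spine-from[] n)
spine-◇□→◇□◇ (keep◇ (copy□ n))             = cong (λ s → ◇ ∷ □ ∷ s) (spine-□→◇ n)
spine-◇□→◇□◇ (merge◇ (erase□ (insert◇ ())))
spine-◇□→◇□◇ (merge◇ (insert◇ (erase□ ())))
spine-◇□→◇□◇ (merge◇ (insert◇ (keep□ n)))  = cong (λ s → ◇ ∷ □ ∷ s) (spine-from[] n)
spine-◇□→◇□◇ (merge◇ (insert◇ (copy□ n)))  = cong (λ s → ◇ ∷ □ ∷ s) (spine-□→◇ n)

spine-◇□→◇ : (n : Normal (◇ ∷ □ ∷ []) (◇ ∷ [])) → spine n ≡ ◇ ∷ []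
spine-◇□→◇ (insert◇ ())
spine-◇□→◇ (keep◇ n)  = cong (◇ ∷_) (spine-to[] n)
spine-◇□→◇ (merge◇ n) = cong (◇ ∷_) (spine-□→◇ n)

spine-□◇□→□◇ : (n : Normal (□ ∷ ◇ ∷ □ ∷ []) (□ ∷ ◇ ∷ [])) → spine n ≡ □ ∷ ◇ ∷ []
spine-□◇□→□◇ (erase□ ())
spine-□◇□→□◇ (keep□ n)                     = cong (□ ∷_) (spine-◇□→◇ n)
spine-□◇□→□◇ (copy□ (erase□ n))            = cong (□ ∷_) (spine-◇□→◇ n)
spine-□◇□→□◇ (copy□ (insert◇ (erase□ ())))

thin-◇□→◇□◇ : (f g : Term (◇ ∷ □ ∷ []) (◇ ∷ □ ∷ ◇ ∷ [])) → f ≈♯ g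
thin-◇□→◇□◇ f g = coherent (alt (alt [] tt) tt) (alt (alt (alt [] tt) tt) tt) f g
  (inj₂ (trans (spine-◇□→◇□◇ (normalise f)) (sym (spine-◇□→◇□◇ (normalise g)))))

thin-□◇□→□◇ : (f g : Term (□ ∷ ◇ ∷ □ ∷ []) (□ ∷ ◇ ∷ [])) → f ≈♯ g
thin-□◇□→□◇ f g = coherent (alt (alt (alt [] tt) tt) tt) (alt (alt [] tt) tt) f g
  (inj₂ (trans (spine-□◇□→□◇ (normalise f)) (sym (spine-□◇□→□◇ (normalise g)))))

from□ : (X : Mod) → Term (□ ∷ []) X
from□ []      = ε□ []
from□ (◇ ∷ X) = ε◇ X ∘ from□ X
from□ (□ ∷ X) = [ □ ] from□ X ∘ δ□□ []

to◇ : (Y : Mod) → Term Y (◇ ∷ [])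
to◇ []      = ε◇ []
to◇ (□ ∷ Y) = to◇ Y ∘ ε□ Y
to◇ (◇ ∷ Y) = δ◇◇ [] ∘ [ ◇ ] to◇ Y

module _ {Ax : Axioms} where
  open ≈-Reasoning

  -- Whiskered by □◇ from□ and ◇□ to◇, the two sides land in thin hom-sets as outer□ and outer◇.
  collapse-crossing : {A B : Mod} (n₁ : Normal (◇ ∷ A) (◇ ∷ □ ∷ B)) (n₂ : Normal (□ ∷ ◇ ∷ A) (□ ∷ B)) →
                       Ax ⊢ ⟦ erase□ n₁ ⟧ ≈ᵘ ⟦ insert◇ n₂ ⟧ → Collapses Ax
  collapse-crossing {A} {B} n₁ n₂ u =
    ≈ᵘ-resp-≈♯ insert◇-side erase□-side (≈ᵘ-sym (∘-congˡᵘ after (∘-congʳᵘ before u)))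
    where
    before : Term (□ ∷ ◇ ∷ □ ∷ []) (□ ∷ ◇ ∷ A)
    before = [ □ ] [ ◇ ] from□ A
    after : Term (◇ ∷ □ ∷ B) (◇ ∷ □ ∷ ◇ ∷ [])
    after = [ ◇ ] [ □ ] to◇ B
    erase□-side : (after ∘ ((⟦ n₁ ⟧ ∘ ε□ (◇ ∷ A)) ∘ before)) ≈♯ outer□
    erase□-side = begin
      after ∘ ((⟦ n₁ ⟧ ∘ ε□ (◇ ∷ A)) ∘ before)             ≈⟨ ∘-congˡ (sym-assoc _ _ _) ⟩
      after ∘ (⟦ n₁ ⟧ ∘ (ε□ (◇ ∷ A) ∘ before))             ≈⟨ ∘-congˡ (∘-congˡ (nat-ε□ ([ ◇ ] from□ A))) ⟨
      after ∘ (⟦ n₁ ⟧ ∘ ([ ◇ ] from□ A ∘ ε□ (◇ ∷ □ ∷ []))) ≈⟨ ∘-congˡ (assoc _ _ _) ⟩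
      after ∘ ((⟦ n₁ ⟧ ∘ [ ◇ ] from□ A) ∘ ε□ (◇ ∷ □ ∷ [])) ≈⟨ assoc _ _ _ ⟩
      (after ∘ (⟦ n₁ ⟧ ∘ [ ◇ ] from□ A)) ∘ ε□ (◇ ∷ □ ∷ []) ≈⟨ ∘-congʳ (thin-◇□→◇□◇ _ _) ⟩
      outer□                                            ∎
    insert◇-side : (after ∘ ((ε◇ (□ ∷ B) ∘ ⟦ n₂ ⟧) ∘ before)) ≈♯ outer◇
    insert◇-side = begin
      after ∘ ((ε◇ (□ ∷ B) ∘ ⟦ n₂ ⟧) ∘ before)             ≈⟨ ∘-congˡ (sym-assoc _ _ _) ⟩
      after ∘ (ε◇ (□ ∷ B) ∘ (⟦ n₂ ⟧ ∘ before))             ≈⟨ assoc _ _ _ ⟩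
      (after ∘ ε◇ (□ ∷ B)) ∘ (⟦ n₂ ⟧ ∘ before)             ≈⟨ ∘-congʳ (nat-ε◇ ([ □ ] to◇ B)) ⟩
      (ε◇ (□ ∷ ◇ ∷ []) ∘ [ □ ] to◇ B) ∘ (⟦ n₂ ⟧ ∘ before) ≈⟨ sym-assoc _ _ _ ⟩
      ε◇ (□ ∷ ◇ ∷ []) ∘ ([ □ ] to◇ B ∘ (⟦ n₂ ⟧ ∘ before)) ≈⟨ ∘-congˡ (thin-□◇□→□◇ _ _) ⟩
      outer◇                                            ∎

module _ {Ax : Axioms} where
  open ≈-Reasoning

  ε◇-then-ε□ : {A B : Mod} (f : Term A (□ ∷ ◇ ∷ B)) →
               Ax ⊢ ((δ◇◇ B ∘ [ ◇ ] ε□ (◇ ∷ B)) ∘ (ε◇ (□ ∷ ◇ ∷ B) ∘ f)) ≈ (ε□ (◇ ∷ B) ∘ f)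
  ε◇-then-ε□ {B = B} f = begin
    (δ◇◇ B ∘ [ ◇ ] ε□ (◇ ∷ B)) ∘ (ε◇ (□ ∷ ◇ ∷ B) ∘ f)      ≈⟨ sym-assoc _ _ _ ⟩
    δ◇◇ B ∘ ([ ◇ ] ε□ (◇ ∷ B) ∘ (ε◇ (□ ∷ ◇ ∷ B) ∘ f))      ≈⟨ ∘-congˡ (assoc _ _ _) ⟩
    δ◇◇ B ∘ (([ ◇ ] ε□ (◇ ∷ B) ∘ ε◇ (□ ∷ ◇ ∷ B)) ∘ f)      ≈⟨ ∘-congˡ (∘-congʳ (nat-ε◇ (ε□ (◇ ∷ B)))) ⟩
    δ◇◇ B ∘ ((ε◇ (◇ ∷ B) ∘ ε□ (◇ ∷ B)) ∘ f)                ≈⟨ ∘-congˡ (sym-assoc _ _ _) ⟩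
    δ◇◇ B ∘ (ε◇ (◇ ∷ B) ∘ (ε□ (◇ ∷ B) ∘ f))                ≈⟨ assoc _ _ _ ⟩
    (δ◇◇ B ∘ ε◇ (◇ ∷ B)) ∘ (ε□ (◇ ∷ B) ∘ f)                ≈⟨ ∘-congʳ (◇-unitˡ B) ⟩
    𝟙 _ ∘ (ε□ (◇ ∷ B) ∘ f)                                 ≈⟨ idˡ _ ⟩
    ε□ (◇ ∷ B) ∘ f                                         ∎

  ε□-then-ε◇ : {A B : Mod} (f : Term (◇ ∷ □ ∷ A) B) →
               Ax ⊢ ((f ∘ ε□ (◇ ∷ □ ∷ A)) ∘ ([ □ ] ε◇ (□ ∷ A) ∘ δ□□ A)) ≈ (f ∘ ε◇ (□ ∷ A))
  ε□-then-ε◇ {A} f = begin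
    (f ∘ ε□ (◇ ∷ □ ∷ A)) ∘ ([ □ ] ε◇ (□ ∷ A) ∘ δ□□ A)      ≈⟨ sym-assoc _ _ _ ⟩
    f ∘ (ε□ (◇ ∷ □ ∷ A) ∘ ([ □ ] ε◇ (□ ∷ A) ∘ δ□□ A))      ≈⟨ ∘-congˡ (assoc _ _ _) ⟩
    f ∘ ((ε□ (◇ ∷ □ ∷ A) ∘ [ □ ] ε◇ (□ ∷ A)) ∘ δ□□ A)      ≈⟨ ∘-congˡ (∘-congʳ (nat-ε□ (ε◇ (□ ∷ A)))) ⟨
    f ∘ ((ε◇ (□ ∷ A) ∘ ε□ (□ ∷ A)) ∘ δ□□ A)                ≈⟨ ∘-congˡ (sym-assoc _ _ _) ⟩
    f ∘ (ε◇ (□ ∷ A) ∘ (ε□ (□ ∷ A) ∘ δ□□ A))                ≈⟨ ∘-congˡ (∘-congˡ (□-unitˡ A)) ⟩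
    f ∘ (ε◇ (□ ∷ A) ∘ 𝟙 _)                                 ≈⟨ ∘-congˡ (idʳ _) ⟩
    f ∘ ε◇ (□ ∷ A)                                         ∎

module _ {Ax : Axioms} where

  mutual
    collapse : {A B : Mod} → Alternating A → Alternating B → (n₁ n₂ : Normal A B) →
               spine n₁ ≢ spine n₂ → Ax ⊢ ⟦ n₁ ⟧ ≈ᵘ ⟦ n₂ ⟧ → Collapses Ax
    collapse {B = □ ∷ B} a (alt b _) n₁ n₂ ne u =
      collapse a b (postε□ n₁) (postε□ n₂)
        (spine-postε□-≢ n₁ n₂ ne)
        (≈ᵘ-resp-≈♯ (≈-sym (postε□-sound n₁)) (≈-sym (postε□-sound n₂)) (∘-congˡᵘ (ε□ B) u))
    collapse {◇ ∷ A} (alt a _) b n₁ n₂ ne u =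
      collapse a b (preε◇ n₁) (preε◇ n₂)
        (spine-preε◇-≢ n₁ n₂ ne)
        (≈ᵘ-resp-≈♯ (≈-sym (preε◇-sound n₁)) (≈-sym (preε◇-sound n₂)) (∘-congʳᵘ (ε◇ A) u))
    collapse {[]} {[]} a b id[] id[] ne u = ⊥-elim (ne refl)
    collapse {[]} {◇ ∷ B} a b (insert◇ n₁) (insert◇ n₂) ne u = collapse-insert◇ a b n₁ n₂ ne u
    collapse {□ ∷ A} {[]} a b (erase□ n₁) (erase□ n₂) ne u = collapse-erase□ a b n₁ n₂ ne u
    collapse {□ ∷ A} {◇ ∷ B} a b (erase□ n₁) (erase□ n₂) ne u = collapse-erase□ a b n₁ n₂ ne u
    collapse {□ ∷ A} {◇ ∷ B} a b (erase□ n₁) (insert◇ n₂) ne u = collapse-erase□-insert◇ a b n₁ n₂ ne u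
    collapse {□ ∷ A} {◇ ∷ B} a b (insert◇ n₁) (erase□ n₂) ne u =
      collapse-erase□-insert◇ a b n₂ n₁ (λ e → ne (sym e)) (≈ᵘ-sym u)
    collapse {□ ∷ A} {◇ ∷ B} a b (insert◇ n₁) (insert◇ n₂) ne u = collapse-insert◇ a b n₁ n₂ ne u

    collapse-insert◇ : {A B : Mod} → Alternating A → Alternating (◇ ∷ B) → (n₁ n₂ : Normal A B) →
      spine n₁ ≢ spine n₂ → Ax ⊢ ⟦ insert◇ n₁ ⟧ ≈ᵘ ⟦ insert◇ n₂ ⟧ → Collapses Ax
    collapse-insert◇ {B = []} a b n₁ n₂ ne u = ⊥-elim (ne (trans (spine-to[] n₁) (sym (spine-to[] n₂))))
    collapse-insert◇ {B = ◇ ∷ B} a (alt _ ()) n₁ n₂ ne u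
    collapse-insert◇ {B = □ ∷ []} a b n₁ n₂ ne u =
      ⊥-elim (spine-postε□-≢ n₁ n₂ ne (trans (spine-to[] (postε□ n₁)) (sym (spine-to[] (postε□ n₂)))))
    collapse-insert◇ {B = □ ∷ □ ∷ B} a (alt (alt _ ()) _) n₁ n₂ ne u
    collapse-insert◇ {B = □ ∷ ◇ ∷ B} a (alt (alt b _) _) n₁ n₂ ne u =
      collapse a b (postε□ n₁) (postε□ n₂)
        (spine-postε□-≢ n₁ n₂ ne)
        (≈ᵘ-resp-≈♯ (≈-trans (ε◇-then-ε□ ⟦ n₁ ⟧) (≈-sym (postε□-sound n₁)))
                    (≈-trans (ε◇-then-ε□ ⟦ n₂ ⟧) (≈-sym (postε□-sound n₂)))
                    (∘-congˡᵘ (δ◇◇ B ∘ [ ◇ ] ε□ (◇ ∷ B)) u))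

    collapse-erase□ : {A B : Mod} → Alternating (□ ∷ A) → Alternating B → (n₁ n₂ : Normal A B) →
      spine n₁ ≢ spine n₂ → Ax ⊢ ⟦ erase□ n₁ ⟧ ≈ᵘ ⟦ erase□ n₂ ⟧ → Collapses Ax
    collapse-erase□ {[]} a b n₁ n₂ ne u = ⊥-elim (ne (trans (spine-from[] n₁) (sym (spine-from[] n₂))))
    collapse-erase□ {□ ∷ A} (alt _ ()) b n₁ n₂ ne u
    collapse-erase□ {◇ ∷ []} a b n₁ n₂ ne u =
      ⊥-elim (spine-preε◇-≢ n₁ n₂ ne (trans (spine-from[] (preε◇ n₁)) (sym (spine-from[] (preε◇ n₂)))))
    collapse-erase□ {◇ ∷ ◇ ∷ A} (alt (alt _ ()) _) b n₁ n₂ ne u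
    collapse-erase□ {◇ ∷ □ ∷ A} (alt (alt a _) _) b n₁ n₂ ne u =
      collapse a b (preε◇ n₁) (preε◇ n₂)
        (spine-preε◇-≢ n₁ n₂ ne)
        (≈ᵘ-resp-≈♯ (≈-trans (ε□-then-ε◇ ⟦ n₁ ⟧) (≈-sym (preε◇-sound n₁)))
                    (≈-trans (ε□-then-ε◇ ⟦ n₂ ⟧) (≈-sym (preε◇-sound n₂)))
                    (∘-congʳᵘ ([ □ ] ε◇ (□ ∷ A) ∘ δ□□ A) u))

    collapse-erase□-insert◇ : {A B : Mod} → Alternating (□ ∷ A) → Alternating (◇ ∷ B) →
      (n₁ : Normal A (◇ ∷ B)) (n₂ : Normal (□ ∷ A) B) →
      spine n₁ ≢ spine n₂ → Ax ⊢ ⟦ erase□ n₁ ⟧ ≈ᵘ ⟦ insert◇ n₂ ⟧ → Collapses Ax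
    collapse-erase□-insert◇ (alt _ ()) b (erase□ n₁) n₂ ne u
    collapse-erase□-insert◇ a b (insert◇ n₁) n₂ ne u =
      collapse-insert◇ a b (erase□ n₁) n₂ ne (≈ᵘ-resp-≈♯ (erase□-insert◇ n₁) ≈-refl u)
    collapse-erase□-insert◇ a b n₁@(keep◇ _) (erase□ n₂) ne u =
      collapse-erase□ a b n₁ (insert◇ n₂) ne (≈ᵘ-resp-≈♯ ≈-refl (≈-sym (erase□-insert◇ n₂)) u)
    collapse-erase□-insert◇ a b n₁@(merge◇ _) (erase□ n₂) ne u =
      collapse-erase□ a b n₁ (insert◇ n₂) ne (≈ᵘ-resp-≈♯ ≈-refl (≈-sym (erase□-insert◇ n₂)) u)
    collapse-erase□-insert◇ a (alt _ ()) (keep◇ n₁) (insert◇ n₂) ne u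
    collapse-erase□-insert◇ a (alt _ ()) (merge◇ n₁) (insert◇ n₂) ne u
    collapse-erase□-insert◇ a b n₁@(keep◇ _) n₂@(keep□ _) ne u = collapse-crossing n₁ n₂ u
    collapse-erase□-insert◇ a b n₁@(keep◇ _) n₂@(copy□ _) ne u = collapse-crossing n₁ n₂ u
    collapse-erase□-insert◇ a b n₁@(merge◇ _) n₂@(keep□ _) ne u = collapse-crossing n₁ n₂ u
    collapse-erase□-insert◇ a b n₁@(merge◇ _) n₂@(copy□ _) ne u = collapse-crossing n₁ n₂ u

-- Reduction to alternating modalities

push : Sym → Mod → Mod
push □ (□ ∷ X) = □ ∷ X
push ◇ (◇ ∷ X) = ◇ ∷ X
push M X       = M ∷ X

reduce : Mod → Mod
reduce []      = []
reduce (M ∷ A) = push M (reduce A)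

push-alternating : (M : Sym) {X : Mod} → Alternating X → Alternating (push M X)
push-alternating □ {[]}    x = alt x tt
push-alternating □ {□ ∷ X} x = x
push-alternating □ {◇ ∷ X} x = alt x tt
push-alternating ◇ {[]}    x = alt x tt
push-alternating ◇ {◇ ∷ X} x = x
push-alternating ◇ {□ ∷ X} x = alt x tt

reduce-alternating : (A : Mod) → Alternating (reduce A)
reduce-alternating []      = []
reduce-alternating (M ∷ A) = push-alternating M (reduce-alternating A)

contract : (M : Sym) (X : Mod) → Term (M ∷ X) (push M X)
contract □ (□ ∷ X) = ε□ (□ ∷ X)
contract ◇ (◇ ∷ X) = δ◇◇ X
contract □ []      = 𝟙 _
contract □ (◇ ∷ X) = 𝟙 _
contract ◇ []      = 𝟙 _
contract ◇ (□ ∷ X) = 𝟙 _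

expand : (M : Sym) (X : Mod) → Term (push M X) (M ∷ X)
expand □ (□ ∷ X) = δ□□ X
expand ◇ (◇ ∷ X) = ε◇ (◇ ∷ X)
expand □ []      = 𝟙 _
expand □ (◇ ∷ X) = 𝟙 _
expand ◇ []      = 𝟙 _
expand ◇ (□ ∷ X) = 𝟙 _

toReduced : (A : Mod) → Term A (reduce A)
toReduced []      = 𝟙 []
toReduced (M ∷ A) = contract M (reduce A) ∘ [ M ] toReduced A

fromReduced : (A : Mod) → Term (reduce A) A
fromReduced []      = 𝟙 []
fromReduced (M ∷ A) = [ M ] fromReduced A ∘ expand M (reduce A)

module _ {Ax : Axioms} where
  open ≈-Reasoning

  -- The only uses of the ♯ equations.
  δ□□∘ε□≈𝟙 : (A : Mod) → Ax ⊢ (δ□□ A ∘ ε□ (□ ∷ A)) ≈ 𝟙 (□ ∷ □ ∷ A)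
  δ□□∘ε□≈𝟙 A = begin
    δ□□ A ∘ ε□ (□ ∷ A)                  ≈⟨ ∘-congˡ (♯□ A) ⟨
    δ□□ A ∘ [ □ ] ε□ A                  ≈⟨ nat-δ□□ (ε□ A) ⟨
    [ □ ] [ □ ] ε□ A ∘ δ□□ (□ ∷ A)      ≈⟨ ∘-congʳ (M-cong □ (♯□ A)) ⟩
    [ □ ] ε□ (□ ∷ A) ∘ δ□□ (□ ∷ A)      ≈⟨ □-unitʳ (□ ∷ A) ⟩
    𝟙 _                                 ∎

  ε◇∘δ◇◇≈𝟙 : (A : Mod) → Ax ⊢ (ε◇ (◇ ∷ A) ∘ δ◇◇ A) ≈ 𝟙 (◇ ∷ ◇ ∷ A)
  ε◇∘δ◇◇≈𝟙 A = begin
    ε◇ (◇ ∷ A) ∘ δ◇◇ A                  ≈⟨ ∘-congʳ (♯◇ A) ⟨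
    [ ◇ ] ε◇ A ∘ δ◇◇ A                  ≈⟨ nat-δ◇◇ (ε◇ A) ⟩
    δ◇◇ (◇ ∷ A) ∘ [ ◇ ] [ ◇ ] ε◇ A      ≈⟨ ∘-congˡ (M-cong ◇ (♯◇ A)) ⟩
    δ◇◇ (◇ ∷ A) ∘ [ ◇ ] ε◇ (◇ ∷ A)      ≈⟨ ◇-unitʳ (◇ ∷ A) ⟩
    𝟙 _                                 ∎

  expand∘contract : (M : Sym) (X : Mod) → Ax ⊢ (expand M X ∘ contract M X) ≈ 𝟙 (M ∷ X)
  expand∘contract □ (□ ∷ X) = δ□□∘ε□≈𝟙 X
  expand∘contract ◇ (◇ ∷ X) = ε◇∘δ◇◇≈𝟙 X
  expand∘contract □ []      = idˡ _
  expand∘contract □ (◇ ∷ X) = idˡ _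
  expand∘contract ◇ []      = idˡ _
  expand∘contract ◇ (□ ∷ X) = idˡ _

  fromReduced∘toReduced : (A : Mod) → Ax ⊢ (fromReduced A ∘ toReduced A) ≈ 𝟙 A
  fromReduced∘toReduced []      = idˡ _
  fromReduced∘toReduced (M ∷ A) = begin
    ([ M ] fromReduced A ∘ expand M (reduce A)) ∘ (contract M (reduce A) ∘ [ M ] toReduced A)
      ≈⟨ sym-assoc _ _ _ ⟩
    [ M ] fromReduced A ∘ (expand M (reduce A) ∘ (contract M (reduce A) ∘ [ M ] toReduced A))
      ≈⟨ ∘-congˡ (assoc _ _ _) ⟩
    [ M ] fromReduced A ∘ ((expand M (reduce A) ∘ contract M (reduce A)) ∘ [ M ] toReduced A)
      ≈⟨ ∘-congˡ (≈-trans (∘-congʳ (expand∘contract M (reduce A))) (idˡ _)) ⟩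
    [ M ] fromReduced A ∘ [ M ] toReduced A
      ≈⟨ [ M ]-resp-∘ (fromReduced∘toReduced A) ⟩
    [ M ] 𝟙 A
      ≈⟨ M-id M A ⟩
    𝟙 (M ∷ A) ∎

reduceArrow : {A B : Mod} → Term A B → Term (reduce A) (reduce B)
reduceArrow {A} {B} f = toReduced B ∘ (f ∘ fromReduced A)

module _ {Ax : Axioms} where
  open ≈-Reasoning

  ≈-from-reduced : {A B : Mod} {f g : Term A B} → Ax ⊢ reduceArrow f ≈ reduceArrow g → Ax ⊢ f ≈ g
  ≈-from-reduced {A} {B} {f} {g} p = ≈-trans (expand-reduceArrow f)
    (≈-trans (∘-congˡ (∘-congʳ p)) (≈-sym (expand-reduceArrow g)))
    where
    expand-reduceArrow : (h : Term A B) → Ax ⊢ h ≈ (fromReduced B ∘ (reduceArrow h ∘ toReduced A))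
    expand-reduceArrow h = begin
      h
        ≈⟨ idˡ h ⟨
      𝟙 B ∘ h
        ≈⟨ ∘-congʳ (fromReduced∘toReduced B) ⟨
      (fromReduced B ∘ toReduced B) ∘ h
        ≈⟨ ∘-congˡ (idʳ h) ⟨
      (fromReduced B ∘ toReduced B) ∘ (h ∘ 𝟙 A)
        ≈⟨ ∘-congˡ (∘-congˡ (fromReduced∘toReduced A)) ⟨
      (fromReduced B ∘ toReduced B) ∘ (h ∘ (fromReduced A ∘ toReduced A))
        ≈⟨ sym-assoc _ _ _ ⟩
      fromReduced B ∘ (toReduced B ∘ (h ∘ (fromReduced A ∘ toReduced A)))
        ≈⟨ ∘-congˡ (∘-congˡ (assoc _ _ _)) ⟩
      fromReduced B ∘ (toReduced B ∘ ((h ∘ fromReduced A) ∘ toReduced A))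
        ≈⟨ ∘-congˡ (assoc _ _ _) ⟩
      fromReduced B ∘ (reduceArrow h ∘ toReduced A)
        ∎

_≟ₛ_ : (M N : Sym) → Dec (M ≡ N)
□ ≟ₛ □ = yes refl
□ ≟ₛ ◇ = no (λ ())
◇ ≟ₛ □ = no (λ ())
◇ ≟ₛ ◇ = yes refl

mainTheorem8 : {A B : Mod} (f g : Term A B) → ¬ (f ≈♯ g) →
    IsPreorder (Universally f g)
mainTheorem8 {A} {B} f g f≉g {C} {D} h k
  with ≡-dec _≟ₛ_ (spine (normalise (reduceArrow f))) (spine (normalise (reduceArrow g)))
... | yes same = ⊥-elim (f≉g (≈-from-reduced
        (coherent (reduce-alternating A) (reduce-alternating B) _ _ (inj₂ same))))
... | no differ = ≈-from-reduced
        (coherent (reduce-alternating C) (reduce-alternating D) _ _ (inj₁ collapses))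
  where
  f≈ᵘg : Universally f g ⊢ ⟦ normalise (reduceArrow f) ⟧ ≈ᵘ ⟦ normalise (reduceArrow g) ⟧
  f≈ᵘg = ≈ᵘ-resp-≈♯ (normalise-sound _) (normalise-sound _)
           (∘-congˡᵘ (toReduced B) (∘-congʳᵘ (fromReduced A) (λ E → ax (inst E))))
  collapses : Collapses (Universally f g)
  collapses = collapse (reduce-alternating A) (reduce-alternating B) _ _ differ f≈ᵘg
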